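{- For $n\ge 1$, let $y_n$ be the number of rows with the value $0$ (false) in the truth tables of all bracketed m-implications with $n$ distinct variables, i.e. $y_n=\sum_{\phi}\#\{\nu:\{p_1,\dots,p_n\}\to\{0,1\} : \nu(\phi)=0\}$, the sum running over all well-formed formulae $\phi$ obtained from $p_1\rightharpoonup p_2\rightharpoonup\cdots\rightharpoonup p_n$ by inserting brackets. Let $C_i=\frac{1}{i}\binom{2i-2}{i-1}$ for $i\ge1$. Then, with $y_0=0$ and $y_1=1$, \[ y_n=\sum_{i=1}^{n-1}\big(2^iC_i-y_i\big)\big(2^{n-i}C_{n-i}-y_{n-i}\big)\qquad (n\ge 2). \]
   Context: Truth values are written $1$ (true) and $0$ (false). The binary connective $\rightharpoonup$ ("m-implication") is defined by $\phi\rightharpoonup\psi\equiv\phi\to\neg\psi$; equivalently, for any valuation $\nu$, $\nu(\phi\rightharpoonup\psi)=0$ if $\nu(\phi)=1$ and $\nu(\psi)=1$, and $\nu(\phi\rightharpoonup\psi)=1$ otherwise. The variables $p_1,\ldots,p_n$ are distinct and appear in this order; the number of bracketings of $p_1\rightharpoonup\cdots\rightharpoonup p_n$ is the Catalan number $C_n=\frac1n\binom{2n-2}{n-1}$ (so $C_1=C_2=1$, $C_3=2$), and each truth table has $2^n$ rows. -}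

module Defs where

open import Data.Nat using (ℕ; zero; suc; _+_; _*_; _∸_; _^_; _/_)
open import Data.Nat.Combinatorics using (_C_)
open import Data.Bool using (Bool; true; false; _∧_; not)
open import Data.List using (List; []; _∷_; concatMap; map; length; filter; drop; take)
import Data.List
open import Data.Nat.ListAction using (sum)
open import Data.Vec using (Vec; toList)
import Data.Vec as V
open import Relation.Nullary.Decidable using (¬?)
open import Data.Bool.Properties using (T?)

_⇀_ : Bool → Bool → Bool
a ⇀ b = not (a ∧ b)

-- Bracketings of p₁ ⇀ ⋯ ⇀ pₙ: binary trees whose leaves, read from left to
-- right, are the variables p₁, …, pₙ (so a leaf need not record its index).
data Br : Set where
  var  : Br
  _⇀ᶠ_ : Br → Br → Br

size : Br → ℕ
size var       = 1
size (φ ⇀ᶠ ψ) = size φ + size ψ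

-- Evaluation: ν lists the values ν(p₁), …, ν(pₙ) in order; the left
-- subformula uses the first (size φ) values, the right one the rest.
eval : Br → List Bool → Bool
eval var       []      = false   -- never used for well-sized inputs
eval var       (b ∷ _) = b
eval (φ ⇀ᶠ ψ) ν       = eval φ (take (size φ) ν) ⇀ eval ψ (drop (size φ) ν)

-- gen f n : all bracketings with exactly n variables (correct when f ≥ n;
-- f is only a recursion budget).
gen : ℕ → ℕ → List Br
gen zero    _       = []
gen (suc f) zero    = []
gen (suc f) (suc zero) = var ∷ []
gen (suc f) n@(suc (suc _)) =
  concatMap (λ i → concatMap (λ φ → map (φ ⇀ᶠ_) (gen f (n ∸ i))) (gen f i))
            (Data.List.map suc (Data.List.upTo (n ∸ 1)))

brackets : ℕ → List Br
brackets n = gen n n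

valuations : (n : ℕ) → List (Vec Bool n)
valuations zero    = V.[] ∷ []
valuations (suc n) = concatMap (λ v → (false V.∷ v) ∷ (true V.∷ v) ∷ []) (valuations n)

falseRows : (n : ℕ) → Br → ℕ
falseRows n φ = length (filter (λ ν → ¬? (T? (eval φ (toList ν)))) (valuations n))

y : ℕ → ℕ
y n = sum (map (falseRows n) (brackets n))

-- Catalan numbers as in the paper: C_i = (1/i) binom(2i-2, i-1), i ≥ 1
catalan : ℕ → ℕ
catalan zero    = 0   -- not used
catalan (suc i) = ((2 * i) C i) / suc i

sumFrom1 : ℕ → (ℕ → ℕ) → ℕ
sumFrom1 n f = sum (map (λ i → f (suc i)) (Data.List.upTo (n ∸ 1)))

-- A bracketing of p₁ ⇀ ⋯ ⇀ pₙ (n ≥ 2) is uniquely φ ⇀ ψ with φ a bracketing of the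
-- first i variables and ψ one of the remaining n − i. A row of φ ⇀ ψ is 0 exactly
-- when it is 1 for both φ and ψ, so the 0-rows of φ ⇀ ψ are the pairs of 1-rows,
-- and summing over all splits gives yₙ = Σᵢ xᵢ xₙ₋ᵢ, where xᵢ, the number of 1-rows
-- over all bracketings of i variables, is 2ⁱ bᵢ − yᵢ with bᵢ the number of
-- bracketings. The split also gives the convolution recursion for bᵢ, and bᵢ = Cᵢ
-- follows from the ballot formula [xᵐ] c(x)ᵏ = C(2m+k−1, m) − C(2m+k−1, m−1) for the
-- powers of the Catalan generating function c = 1 + x c².
module Submission where

open import Defs

open import Data.Bool using (Bool; true; false; not; _∧_; if_then_else_)
open import Data.Bool.Properties using (not-involutive)
open import Data.List using (List; []; _∷_; _++_; map; concat; concatMap; applyUpTo; upTo; take; drop; length; filter)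
open import Data.List.Properties using (map-∘; map-++; map-cong-local; concatMap-map; map-upTo)
open import Data.List.Relation.Unary.All using (All; []; _∷_)
import Data.List.Relation.Unary.All as All
open import Data.List.Relation.Unary.All.Properties using (all-upTo; concat⁺; map⁺)
open import Data.Nat using (ℕ; zero; suc; _+_; _*_; _∸_; _^_; _≤_; _<_; z≤n; s≤s; _/_)
open import Data.Nat.Combinatorics using (_C_; nCk+nC[k+1]≡[n+1]C[k+1]; nCk≡nC[n∸k]; nC1≡n)
open import Data.Nat.DivMod using (m*n/n≡m)
open import Data.Nat.Induction using (<-rec)
open import Data.Nat.ListAction using (sum)
open import Data.Nat.ListAction.Properties using (sum-++)
open import Data.Nat.Properties
open import Data.Nat.Tactic.RingSolver using (solve-∀)
open import Data.Product using (_×_; _,_)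
open import Data.Vec using (Vec; toList)
import Data.Vec as V
open import Function using (_∘_)
open import Relation.Binary.PropositionalEquality
open import Relation.Nullary using (does; contradiction)
open import Relation.Unary using (Decidable)
open import Algebra.Properties.CommutativeSemigroup +-commutativeSemigroup using (interchange)

[k+1]*[n+1]C[k+1]≡[n+1]*nCk : ∀ n k → suc k * (suc n C suc k) ≡ suc n * (n C k)
[k+1]*[n+1]C[k+1]≡[n+1]*nCk zero    zero    = refl
[k+1]*[n+1]C[k+1]≡[n+1]*nCk zero    (suc k) = *-zeroʳ (2 + k)
[k+1]*[n+1]C[k+1]≡[n+1]*nCk (suc n) zero    =
  trans (*-identityˡ _) (trans (nC1≡n (2 + n)) (sym (*-identityʳ (2 + n))))
[k+1]*[n+1]C[k+1]≡[n+1]*nCk (suc n) (suc k) = begin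
    (2 + k) * (suc (suc n) C suc (suc k))
  ≡⟨ cong ((2 + k) *_) (nCk+nC[k+1]≡[n+1]C[k+1] (suc n) (suc k)) ⟨
    (2 + k) * (a + b)
  ≡⟨ split k a b ⟩
    a + (1 + k) * a + (2 + k) * b
  ≡⟨ cong₂ (λ u v → a + u + v) ([k+1]*[n+1]C[k+1]≡[n+1]*nCk n k)
                               ([k+1]*[n+1]C[k+1]≡[n+1]*nCk n (suc k)) ⟩
    a + (1 + n) * (n C k) + (1 + n) * (n C suc k)
  ≡⟨ merge n a (n C k) (n C suc k) ⟩
    a + (1 + n) * (n C k + n C suc k)
  ≡⟨ cong (λ z → a + (1 + n) * z) (nCk+nC[k+1]≡[n+1]C[k+1] n k) ⟩
    (2 + n) * a
  ∎
  where
  open ≡-Reasoning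
  a = suc n C suc k
  b = suc n C suc (suc k)
  split : ∀ k a b → (2 + k) * (a + b) ≡ a + (1 + k) * a + (2 + k) * b
  split = solve-∀
  merge : ∀ n a c d → a + (1 + n) * c + (1 + n) * d ≡ a + (1 + n) * (c + d)
  merge = solve-∀

nCk≡nCj : ∀ {n} k j → k + j ≡ n → n C k ≡ n C j
nCk≡nCj k j refl = trans (nCk≡nC[n∸k] (m≤m+n k j)) (cong ((k + j) C_) (m+n∸m≡n k j))

[k+1]*nC[k+1]≡[r+1]*nCk : ∀ {n} k r → k + suc r ≡ n → suc k * (n C suc k) ≡ suc r * (n C k)
[k+1]*nC[k+1]≡[r+1]*nCk {zero}  k r k+r+1≡0 = contradiction (trans (sym (+-suc k r)) k+r+1≡0) 1+n≢0
[k+1]*nC[k+1]≡[r+1]*nCk {suc n} k r k+r+1≡n+1 = begin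
    suc k * (suc n C suc k)
  ≡⟨ [k+1]*[n+1]C[k+1]≡[n+1]*nCk n k ⟩
    suc n * (n C k)
  ≡⟨ cong (suc n *_) (nCk≡nCj k r (suc-injective (trans (sym (+-suc k r)) k+r+1≡n+1))) ⟩
    suc n * (n C r)
  ≡⟨ [k+1]*[n+1]C[k+1]≡[n+1]*nCk n r ⟨
    suc r * (suc n C suc r)
  ≡⟨ cong (suc r *_) (nCk≡nCj k (suc r) k+r+1≡n+1) ⟨
    suc r * (suc n C k)
  ∎
  where open ≡-Reasoning

infixl 7 _⊛_

_⊛_ : (ℕ → ℕ) → (ℕ → ℕ) → ℕ → ℕ
(a ⊛ b) m = sum (applyUpTo (λ j → a j * b (m ∸ j)) (suc m))

⊛-zeroˡ : ∀ b m → ((λ _ → 0) ⊛ b) m ≡ 0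
⊛-zeroˡ b zero    = refl
⊛-zeroˡ b (suc m) = ⊛-zeroˡ b m

⊛-distribʳ-+ : ∀ a a' b m → ((λ j → a j + a' j) ⊛ b) m ≡ (a ⊛ b) m + (a' ⊛ b) m
⊛-distribʳ-+ a a' b zero    = distrib (a 0) (a' 0) (b 0)
  where
  distrib : ∀ x x' z → (x + x') * z + 0 ≡ (x * z + 0) + (x' * z + 0)
  distrib = solve-∀
⊛-distribʳ-+ a a' b (suc m) = begin
    (a 0 + a' 0) * b (suc m) + ((λ j → a (suc j) + a' (suc j)) ⊛ b) m
  ≡⟨ cong₂ _+_ (*-distribʳ-+ (b (suc m)) (a 0) (a' 0)) (⊛-distribʳ-+ (a ∘ suc) (a' ∘ suc) b m) ⟩
    (a 0 * b (suc m) + a' 0 * b (suc m)) + ((a ∘ suc ⊛ b) m + (a' ∘ suc ⊛ b) m)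
  ≡⟨ interchange (a 0 * b (suc m)) _ _ _ ⟩
    (a ⊛ b) (suc m) + (a' ⊛ b) (suc m)
  ∎
  where open ≡-Reasoning

-- catalanPow k m is the coefficient of xᵐ in c(x)ᵏ, where c = 1 + x c² is the
-- Catalan generating function; the recursion is cᵏ⁺¹ = cᵏ + x cᵏ⁺².
catalanPow : ℕ → ℕ → ℕ
catalanPow zero    zero    = 1
catalanPow zero    (suc m) = 0
catalanPow (suc k) zero    = 1
catalanPow (suc k) (suc m) = catalanPow k (suc m) + catalanPow (suc (suc k)) m

catalanPow-zero : ∀ k → catalanPow k 0 ≡ 1
catalanPow-zero zero    = refl
catalanPow-zero (suc k) = refl

catalanPow-one : ∀ k → catalanPow k 1 ≡ k
catalanPow-one zero    = refl
catalanPow-one (suc k) = trans (cong (_+ 1) (catalanPow-one k)) (+-comm k 1)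

catalanPow-suc : ∀ k m → catalanPow (suc k) m ≡ (catalanPow k ⊛ catalanPow 1) m
catalanPow-suc k       zero    = cong (λ c → c * 1 + 0) (sym (catalanPow-zero k))
catalanPow-suc zero    (suc m) = sym (begin
    1 * catalanPow 1 (suc m) + ((λ _ → 0) ⊛ catalanPow 1) m
  ≡⟨ cong (1 * catalanPow 1 (suc m) +_) (⊛-zeroˡ (catalanPow 1) m) ⟩
    1 * catalanPow 1 (suc m) + 0
  ≡⟨ trans (+-identityʳ _) (*-identityˡ _) ⟩
    catalanPow 1 (suc m)
  ∎)
  where open ≡-Reasoning
catalanPow-suc (suc k) (suc m) = begin
    catalanPow (suc k) (suc m) + catalanPow (3 + k) m
  ≡⟨ cong₂ _+_ (catalanPow-suc k (suc m)) (catalanPow-suc (2 + k) m) ⟩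
    (catalanPow k 0 * c (suc m) + (catalanPow k ∘ suc ⊛ c) m) + (catalanPow (2 + k) ⊛ c) m
  ≡⟨ +-assoc (catalanPow k 0 * c (suc m)) _ _ ⟩
    catalanPow k 0 * c (suc m) + ((catalanPow k ∘ suc ⊛ c) m + (catalanPow (2 + k) ⊛ c) m)
  ≡⟨ cong₂ (λ c₀ s → c₀ * c (suc m) + s) (catalanPow-zero k)
           (sym (⊛-distribʳ-+ (catalanPow k ∘ suc) (catalanPow (2 + k)) c m)) ⟩
    (catalanPow (suc k) ⊛ c) (suc m)
  ∎
  where
  open ≡-Reasoning
  c = catalanPow 1

-- The ballot formula, with the subtraction moved to the left-hand side.
catalanPow-binomial : ∀ k m {N} → k + (m + suc m) ≡ N → catalanPow k (suc m) + N C m ≡ N C suc m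
catalanPow-binomial zero    m       eq   = nCk≡nCj m (suc m) eq
catalanPow-binomial k       zero    refl = trans (cong (_+ 1) (catalanPow-one k)) (sym (nC1≡n (k + 1)))
catalanPow-binomial (suc k) (suc m) refl = begin
    (A + B) + suc N C suc m
  ≡⟨ cong ((A + B) +_) (nCk+nC[k+1]≡[n+1]C[k+1] N m) ⟨
    (A + B) + (N C m + N C suc m)
  ≡⟨ regroup A B (N C m) (N C suc m) ⟩
    (A + N C suc m) + (B + N C m)
  ≡⟨ cong₂ _+_ (catalanPow-binomial k (suc m) refl) (catalanPow-binomial (2 + k) m (size-eq k m)) ⟩
    N C suc (suc m) + N C suc m
  ≡⟨ +-comm (N C suc (suc m)) _ ⟩
    N C suc m + N C suc (suc m)
  ≡⟨ nCk+nC[k+1]≡[n+1]C[k+1] N (suc m) ⟩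
    suc N C suc (suc m)
  ∎
  where
  open ≡-Reasoning
  N = k + (suc m + suc (suc m))
  A = catalanPow k (suc (suc m))
  B = catalanPow (2 + k) (suc m)
  regroup : ∀ a b c d → (a + b) + (c + d) ≡ (a + d) + (b + c)
  regroup = solve-∀
  size-eq : ∀ k m → 2 + k + (m + suc m) ≡ k + (suc m + suc (suc m))
  size-eq = solve-∀

central-binomial : ∀ m → (2 * m) C m ≡ catalanPow 1 m * suc m
central-binomial zero    = refl
central-binomial (suc m) = +-cancelʳ-≡ _ _ _ (begin
    c₁ + (2 + m) * c₀
  ≡⟨ cong (c₁ +_) ([k+1]*nC[k+1]≡[r+1]*nCk m (suc m) (size-eq₁ m)) ⟨
    (2 + m) * c₁
  ≡⟨ cong ((2 + m) *_) (catalanPow-binomial 1 m (size-eq₂ m)) ⟨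
    (2 + m) * (g + c₀)
  ≡⟨ *-distribˡ-+ (2 + m) g c₀ ⟩
    (2 + m) * g + (2 + m) * c₀
  ≡⟨ cong (_+ (2 + m) * c₀) (*-comm (2 + m) g) ⟩
    g * (2 + m) + (2 + m) * c₀
  ∎)
  where
  open ≡-Reasoning
  N = 2 * suc m
  g = catalanPow 1 (suc m)
  c₀ = N C m
  c₁ = N C suc m
  size-eq₁ : ∀ m → m + suc (suc m) ≡ 2 * suc m
  size-eq₁ = solve-∀
  size-eq₂ : ∀ m → 1 + (m + suc m) ≡ 2 * suc m
  size-eq₂ = solve-∀

catalan≡catalanPow : ∀ m → catalan (suc m) ≡ catalanPow 1 m
catalan≡catalanPow m = trans (cong (_/ suc m) (central-binomial m)) (m*n/n≡m (catalanPow 1 m) (suc m))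

length≡sum-map-1 : ∀ {A : Set} (xs : List A) → length xs ≡ sum (map (λ _ → 1) xs)
length≡sum-map-1 []       = refl
length≡sum-map-1 (x ∷ xs) = cong suc (length≡sum-map-1 xs)

sum-map-cong : ∀ {A : Set} {f g : A → ℕ} {xs} → All (λ x → f x ≡ g x) xs → sum (map f xs) ≡ sum (map g xs)
sum-map-cong = cong sum ∘ map-cong-local

sum-map-*ˡ : ∀ {A : Set} c (f : A → ℕ) xs → sum (map (λ x → c * f x) xs) ≡ c * sum (map f xs)
sum-map-*ˡ c f []       = sym (*-zeroʳ c)
sum-map-*ˡ c f (x ∷ xs) = trans (cong (c * f x +_) (sum-map-*ˡ c f xs)) (sym (*-distribˡ-+ c (f x) _))

sum-map-concatMap : ∀ {A B : Set} (h : B → ℕ) (g : A → List B) xs →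
                    sum (map h (concatMap g xs)) ≡ sum (map (sum ∘ map h ∘ g) xs)
sum-map-concatMap h g []       = refl
sum-map-concatMap h g (x ∷ xs) = begin
    sum (map h (g x ++ concatMap g xs))
  ≡⟨ cong sum (map-++ h (g x) _) ⟩
    sum (map h (g x) ++ map h (concatMap g xs))
  ≡⟨ sum-++ (map h (g x)) _ ⟩
    sum (map h (g x)) + sum (map h (concatMap g xs))
  ≡⟨ cong (sum (map h (g x)) +_) (sum-map-concatMap h g xs) ⟩
    sum (map (sum ∘ map h ∘ g) (x ∷ xs))
  ∎
  where open ≡-Reasoning

sum-map+sum-map : ∀ {A : Set} (f g : A → ℕ) c → (∀ x → f x + g x ≡ c) → ∀ xs →
                  sum (map f xs) + sum (map g xs) ≡ c * length xs
sum-map+sum-map f g c f+g≡c []       = sym (*-zeroʳ c)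
sum-map+sum-map f g c f+g≡c (x ∷ xs) = begin
    (f x + sum (map f xs)) + (g x + sum (map g xs))
  ≡⟨ interchange (f x) _ _ _ ⟩
    (f x + g x) + (sum (map f xs) + sum (map g xs))
  ≡⟨ cong₂ _+_ (f+g≡c x) (sum-map+sum-map f g c f+g≡c xs) ⟩
    c + c * length xs
  ≡⟨ *-suc c (length xs) ⟨
    c * length (x ∷ xs)
  ∎
  where open ≡-Reasoning

count : ℕ → (List Bool → Bool) → ℕ
count zero    P = if P [] then 1 else 0
count (suc k) P = count k (P ∘ (false ∷_)) + count k (P ∘ (true ∷_))

length-filter-∷ : ∀ {A : Set} {P : A → Set} (P? : Decidable P) x xs →
  length (filter P? (x ∷ xs)) ≡ (if does (P? x) then 1 else 0) + length (filter P? xs)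
length-filter-∷ P? x xs with does (P? x)
... | true  = refl
... | false = refl

length-filter-concatMap-pair : ∀ {A B : Set} {P : B → Set} (P? : Decidable P) (f g : A → B) xs →
  length (filter P? (concatMap (λ x → f x ∷ g x ∷ []) xs)) ≡
  length (filter (P? ∘ f) xs) + length (filter (P? ∘ g) xs)
length-filter-concatMap-pair P? f g []       = refl
length-filter-concatMap-pair P? f g (x ∷ xs) = begin
    length (filter P? (f x ∷ g x ∷ rest))
  ≡⟨ length-filter-∷ P? (f x) (g x ∷ rest) ⟩
    a + length (filter P? (g x ∷ rest))
  ≡⟨ cong (a +_) (length-filter-∷ P? (g x) rest) ⟩
    a + (b + length (filter P? rest))
  ≡⟨ cong (λ r → a + (b + r)) (length-filter-concatMap-pair P? f g xs) ⟩
    a + (b + (length (filter (P? ∘ f) xs) + length (filter (P? ∘ g) xs)))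
  ≡⟨ +-assoc a b _ ⟨
    (a + b) + (length (filter (P? ∘ f) xs) + length (filter (P? ∘ g) xs))
  ≡⟨ interchange a b _ _ ⟩
    (a + length (filter (P? ∘ f) xs)) + (b + length (filter (P? ∘ g) xs))
  ≡⟨ cong₂ _+_ (length-filter-∷ (P? ∘ f) x xs) (length-filter-∷ (P? ∘ g) x xs) ⟨
    length (filter (P? ∘ f) (x ∷ xs)) + length (filter (P? ∘ g) (x ∷ xs))
  ∎
  where
  open ≡-Reasoning
  rest = concatMap (λ x → f x ∷ g x ∷ []) xs
  a = if does (P? (f x)) then 1 else 0
  b = if does (P? (g x)) then 1 else 0

length-filter-valuations : ∀ k {Q : Vec Bool k → Set} (Q? : Decidable Q) (p : List Bool → Bool) →
  (∀ ν → does (Q? ν) ≡ p (toList ν)) → length (filter Q? (valuations k)) ≡ count k p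
length-filter-valuations zero Q? p Q?≡p with does (Q? V.[]) | Q?≡p V.[]
... | true  | Q[] = cong (λ b → if b then 1 else 0) Q[]
... | false | Q[] = cong (λ b → if b then 1 else 0) Q[]
length-filter-valuations (suc k) Q? p Q?≡p = begin
    length (filter Q? (valuations (suc k)))
  ≡⟨ length-filter-concatMap-pair Q? (false V.∷_) (true V.∷_) (valuations k) ⟩
    length (filter (Q? ∘ (false V.∷_)) (valuations k)) + length (filter (Q? ∘ (true V.∷_)) (valuations k))
  ≡⟨ cong₂ _+_ (length-filter-valuations k _ (p ∘ (false ∷_)) (Q?≡p ∘ (false V.∷_)))
               (length-filter-valuations k _ (p ∘ (true ∷_)) (Q?≡p ∘ (true V.∷_))) ⟩
    count (suc k) p
  ∎
  where open ≡-Reasoning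

count-cong : ∀ k {P Q : List Bool → Bool} → (∀ ν → P ν ≡ Q ν) → count k P ≡ count k Q
count-cong zero    P≗Q = cong (λ b → if b then 1 else 0) (P≗Q [])
count-cong (suc k) P≗Q = cong₂ _+_ (count-cong k (P≗Q ∘ (false ∷_))) (count-cong k (P≗Q ∘ (true ∷_)))

count-false : ∀ k → count k (λ _ → false) ≡ 0
count-false zero    = refl
count-false (suc k) = cong₂ _+_ (count-false k) (count-false k)

count+count-not : ∀ k P → count k P + count k (not ∘ P) ≡ 2 ^ k
count+count-not zero    P with P []
... | true  = refl
... | false = refl
count+count-not (suc k) P = begin
    (count k P₀ + count k P₁) + (count k (not ∘ P₀) + count k (not ∘ P₁))
  ≡⟨ interchange (count k P₀) _ _ _ ⟩
    (count k P₀ + count k (not ∘ P₀)) + (count k P₁ + count k (not ∘ P₁))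
  ≡⟨ cong₂ _+_ (count+count-not k P₀) (count+count-not k P₁) ⟩
    2 ^ k + 2 ^ k
  ≡⟨ cong (2 ^ k +_) (+-identityʳ (2 ^ k)) ⟨
    2 ^ suc k
  ∎
  where
  open ≡-Reasoning
  P₀ = P ∘ (false ∷_)
  P₁ = P ∘ (true ∷_)

count-∧ : ∀ i j (A B : List Bool → Bool) →
          count (i + j) (λ ν → A (take i ν) ∧ B (drop i ν)) ≡ count i A * count j B
count-∧ zero    j A B with A []
... | true  = sym (+-identityʳ (count j B))
... | false = count-false j
count-∧ (suc i) j A B = begin
    count (i + j) (λ ν → A (false ∷ take i ν) ∧ B (drop i ν))
      + count (i + j) (λ ν → A (true ∷ take i ν) ∧ B (drop i ν))
  ≡⟨ cong₂ _+_ (count-∧ i j (A ∘ (false ∷_)) B) (count-∧ i j (A ∘ (true ∷_)) B) ⟩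
    count i (A ∘ (false ∷_)) * count j B + count i (A ∘ (true ∷_)) * count j B
  ≡⟨ *-distribʳ-+ (count j B) (count i (A ∘ (false ∷_))) _ ⟨
    count (suc i) A * count j B
  ∎
  where open ≡-Reasoning

trueRows : ℕ → Br → ℕ
trueRows n φ = count n (eval φ)

falseRows≡count : ∀ n φ → falseRows n φ ≡ count n (not ∘ eval φ)
falseRows≡count n φ = length-filter-valuations n _ (not ∘ eval φ) (λ _ → refl)

trueRows+falseRows : ∀ n φ → trueRows n φ + falseRows n φ ≡ 2 ^ n
trueRows+falseRows n φ = trans (cong (trueRows n φ +_) (falseRows≡count n φ)) (count+count-not n (eval φ))

falseRows-⇀ᶠ : ∀ j φ ψ → falseRows (size φ + j) (φ ⇀ᶠ ψ) ≡ trueRows (size φ) φ * trueRows j ψ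
falseRows-⇀ᶠ j φ ψ = begin
    falseRows (size φ + j) (φ ⇀ᶠ ψ)
  ≡⟨ falseRows≡count (size φ + j) (φ ⇀ᶠ ψ) ⟩
    count (size φ + j) (not ∘ eval (φ ⇀ᶠ ψ))
  ≡⟨ count-cong (size φ + j) (λ _ → not-involutive _) ⟩
    count (size φ + j) (λ ν → eval φ (take (size φ) ν) ∧ eval ψ (drop (size φ) ν))
  ≡⟨ count-∧ (size φ) j (eval φ) (eval ψ) ⟩
    trueRows (size φ) φ * trueRows j ψ
  ∎
  where open ≡-Reasoning

infixr 5 _⇀ᴸ_

_⇀ᴸ_ : List Br → List Br → List Br
φs ⇀ᴸ ψs = concatMap (λ φ → map (φ ⇀ᶠ_) ψs) φs

All-⇀ᴸ : ∀ {P : Br → Set} {φs ψs} → All (λ φ → All (λ ψ → P (φ ⇀ᶠ ψ)) ψs) φs → All P (φs ⇀ᴸ ψs)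
All-⇀ᴸ = concat⁺ ∘ map⁺ ∘ All.map map⁺

gen-size : ∀ f n → All (λ φ → size φ ≡ n) (gen f n)
gen-size zero    n             = []
gen-size (suc f) zero          = []
gen-size (suc f) (suc zero)    = refl ∷ []
gen-size (suc f) (suc (suc k)) = concat⁺ (map⁺ (map⁺ (All.map split (all-upTo (suc k)))))
  where
  split : ∀ {i} → i < suc k → All (λ φ → size φ ≡ suc (suc k)) (gen f (suc i) ⇀ᴸ gen f (suc k ∸ i))
  split {i} i<k+1 = All-⇀ᴸ (All.map (λ sizeφ → All.map (λ sizeψ →
      trans (cong₂ _+_ sizeφ sizeψ) (cong suc (m+[n∸m]≡n (<⇒≤ i<k+1))))
    (gen-size f (suc k ∸ i))) (gen-size f (suc i)))

brackets-size : ∀ n → All (λ φ → size φ ≡ n) (brackets n)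
brackets-size n = gen-size n n

gen-zero : ∀ f → gen f 0 ≡ []
gen-zero zero    = refl
gen-zero (suc f) = refl

gen-budget : ∀ n {f g} → n ≤ f → n ≤ g → gen f n ≡ gen g n
gen-budget zero          {f}     {g}     _         _         = trans (gen-zero f) (sym (gen-zero g))
gen-budget (suc zero)    {suc f} {suc g} _         _         = refl
gen-budget (suc (suc k)) {suc f} {suc g} (s≤s k<f) (s≤s k<g) =
  cong concat (map-cong-local (map⁺ (All.map split (all-upTo (suc k)))))
  where
  split : ∀ {i} → i < suc k → gen f (suc i) ⇀ᴸ gen f (suc k ∸ i) ≡ gen g (suc i) ⇀ᴸ gen g (suc k ∸ i)
  split {i} i<k+1 = cong₂ _⇀ᴸ_
    (gen-budget (suc i) (≤-trans i<k+1 k<f) (≤-trans i<k+1 k<g))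
    (gen-budget (suc k ∸ i) (≤-trans (m∸n≤m (suc k) i) k<f) (≤-trans (m∸n≤m (suc k) i) k<g))

bracketsSplitAt : ℕ → ℕ → List Br
bracketsSplitAt m i = brackets (suc i) ⇀ᴸ brackets (suc m ∸ i)

brackets-unfold : ∀ m → brackets (2 + m) ≡ concatMap (bracketsSplitAt m) (upTo (suc m))
brackets-unfold m = trans (concatMap-map _ suc (upTo (suc m)))
  (cong concat (map-cong-local (All.map split (all-upTo (suc m)))))
  where
  split : ∀ {i} → i < suc m →
          gen (suc m) (suc i) ⇀ᴸ gen (suc m) (suc m ∸ i) ≡ bracketsSplitAt m i
  split {i} i<m+1 = cong₂ _⇀ᴸ_ (gen-budget (suc i) i<m+1 ≤-refl)
                               (gen-budget (suc m ∸ i) (m∸n≤m (suc m) i) ≤-refl)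

sum-map-⇀ᴸ : ∀ (h f g : Br → ℕ) {φs ψs} → All (λ φ → All (λ ψ → h (φ ⇀ᶠ ψ) ≡ f φ * g ψ) ψs) φs →
             sum (map h (φs ⇀ᴸ ψs)) ≡ sum (map f φs) * sum (map g ψs)
sum-map-⇀ᴸ h f g {φs} {ψs} h≡f*g = begin
    sum (map h (φs ⇀ᴸ ψs))
  ≡⟨ sum-map-concatMap h _ φs ⟩
    sum (map (λ φ → sum (map h (map (φ ⇀ᶠ_) ψs))) φs)
  ≡⟨ sum-map-cong (All.map row h≡f*g) ⟩
    sum (map (λ φ → sum (map g ψs) * f φ) φs)
  ≡⟨ sum-map-*ˡ (sum (map g ψs)) f φs ⟩
    sum (map g ψs) * sum (map f φs)
  ≡⟨ *-comm (sum (map g ψs)) _ ⟩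
    sum (map f φs) * sum (map g ψs)
  ∎
  where
  open ≡-Reasoning
  row : ∀ {φ} → All (λ ψ → h (φ ⇀ᶠ ψ) ≡ f φ * g ψ) ψs → sum (map h (map (φ ⇀ᶠ_) ψs)) ≡ sum (map g ψs) * f φ
  row {φ} hφ = begin
      sum (map h (map (φ ⇀ᶠ_) ψs))
    ≡⟨ cong sum (map-∘ ψs) ⟨
      sum (map (h ∘ (φ ⇀ᶠ_)) ψs)
    ≡⟨ sum-map-cong hφ ⟩
      sum (map (λ ψ → f φ * g ψ) ψs)
    ≡⟨ sum-map-*ˡ (f φ) g ψs ⟩
      f φ * sum (map g ψs)
    ≡⟨ *-comm (f φ) _ ⟩
      sum (map g ψs) * f φ
    ∎

sum-map-brackets : ∀ m (h : Br → ℕ) →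
  sum (map h (brackets (2 + m))) ≡ sum (map (λ i → sum (map h (bracketsSplitAt m i))) (upTo (suc m)))
sum-map-brackets m h =
  trans (cong (sum ∘ map h) (brackets-unfold m)) (sum-map-concatMap h (bracketsSplitAt m) (upTo (suc m)))

length-⇀ᴸ : ∀ φs ψs → length (φs ⇀ᴸ ψs) ≡ length φs * length ψs
length-⇀ᴸ φs ψs = begin
    length (φs ⇀ᴸ ψs)
  ≡⟨ length≡sum-map-1 (φs ⇀ᴸ ψs) ⟩
    sum (map (λ _ → 1) (φs ⇀ᴸ ψs))
  ≡⟨ sum-map-⇀ᴸ _ _ _ (All.universal (λ _ → All.universal (λ _ → refl) ψs) φs) ⟩
    sum (map (λ _ → 1) φs) * sum (map (λ _ → 1) ψs)
  ≡⟨ cong₂ _*_ (length≡sum-map-1 φs) (length≡sum-map-1 ψs) ⟨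
    length φs * length ψs
  ∎
  where open ≡-Reasoning

length-brackets-suc : ∀ m → length (brackets (suc m)) ≡ catalanPow 1 m
length-brackets-suc = <-rec (λ m → length (brackets (suc m)) ≡ catalanPow 1 m) step
  where
  step : ∀ m → (∀ {k} → k < m → length (brackets (suc k)) ≡ catalanPow 1 k) →
         length (brackets (suc m)) ≡ catalanPow 1 m
  step zero    _  = refl
  step (suc m) ih = begin
      length (brackets (2 + m))
    ≡⟨ length≡sum-map-1 (brackets (2 + m)) ⟩
      sum (map (λ _ → 1) (brackets (2 + m)))
    ≡⟨ sum-map-brackets m (λ _ → 1) ⟩
      sum (map (λ i → sum (map (λ _ → 1) (bracketsSplitAt m i))) (upTo (suc m)))
    ≡⟨ sum-map-cong (All.map split (all-upTo (suc m))) ⟩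
      sum (map (λ i → catalanPow 1 i * catalanPow 1 (m ∸ i)) (upTo (suc m)))
    ≡⟨ cong sum (map-upTo _ (suc m)) ⟩
      (catalanPow 1 ⊛ catalanPow 1) m
    ≡⟨ catalanPow-suc 1 m ⟨
      catalanPow 1 (suc m)
    ∎
    where
    open ≡-Reasoning
    split : ∀ {i} → i < suc m → sum (map (λ _ → 1) (bracketsSplitAt m i)) ≡ catalanPow 1 i * catalanPow 1 (m ∸ i)
    split {i} (s≤s i≤m) = begin
        sum (map (λ _ → 1) (bracketsSplitAt m i))
      ≡⟨ length≡sum-map-1 (bracketsSplitAt m i) ⟨
        length (bracketsSplitAt m i)
      ≡⟨ length-⇀ᴸ (brackets (suc i)) (brackets (suc m ∸ i)) ⟩
        length (brackets (suc i)) * length (brackets (suc m ∸ i))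
      ≡⟨ cong (λ k → length (brackets (suc i)) * length (brackets k)) (+-∸-assoc 1 i≤m) ⟩
        length (brackets (suc i)) * length (brackets (suc (m ∸ i)))
      ≡⟨ cong₂ _*_ (ih (s≤s i≤m)) (ih (s≤s (m∸n≤m m i))) ⟩
        catalanPow 1 i * catalanPow 1 (m ∸ i)
      ∎

length-brackets : ∀ n → length (brackets n) ≡ catalan n
length-brackets zero    = refl
length-brackets (suc m) = trans (length-brackets-suc m) (sym (catalan≡catalanPow m))

sum-trueRows : ∀ n → sum (map (trueRows n) (brackets n)) ≡ 2 ^ n * catalan n ∸ y n
sum-trueRows n = begin
    sum (map (trueRows n) (brackets n))
  ≡⟨ m+n∸n≡m _ (y n) ⟨
    sum (map (trueRows n) (brackets n)) + y n ∸ y n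
  ≡⟨ cong (_∸ y n) (sum-map+sum-map (trueRows n) (falseRows n) (2 ^ n) (trueRows+falseRows n) (brackets n)) ⟩
    2 ^ n * length (brackets n) ∸ y n
  ≡⟨ cong (λ l → 2 ^ n * l ∸ y n) (length-brackets n) ⟩
    2 ^ n * catalan n ∸ y n
  ∎
  where open ≡-Reasoning

sum-falseRows-⇀ᴸ : ∀ {i j n} → i + j ≡ n →
  sum (map (falseRows n) (brackets i ⇀ᴸ brackets j)) ≡ (2 ^ i * catalan i ∸ y i) * (2 ^ j * catalan j ∸ y j)
sum-falseRows-⇀ᴸ {i} {j} refl = trans
  (sum-map-⇀ᴸ (falseRows (i + j)) (trueRows i) (trueRows j) (All.map (λ {φ} → row {φ}) (brackets-size i)))
  (cong₂ _*_ (sum-trueRows i) (sum-trueRows j))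
  where
  row : ∀ {φ} → size φ ≡ i → All (λ ψ → falseRows (i + j) (φ ⇀ᶠ ψ) ≡ trueRows i φ * trueRows j ψ) (brackets j)
  row {φ} refl = All.universal (falseRows-⇀ᶠ j φ) (brackets j)

y-recurrence : ∀ m → let n = 2 + m in
  y n ≡ sumFrom1 n (λ i → (2 ^ i * catalan i ∸ y i) * (2 ^ (n ∸ i) * catalan (n ∸ i) ∸ y (n ∸ i)))
y-recurrence m =
  trans (sum-map-brackets m (falseRows (2 + m))) (sum-map-cong (All.map split (all-upTo (suc m))))
  where
  split : ∀ {i} → i < suc m → sum (map (falseRows (2 + m)) (bracketsSplitAt m i)) ≡
          (2 ^ suc i * catalan (suc i) ∸ y (suc i)) * (2 ^ (suc m ∸ i) * catalan (suc m ∸ i) ∸ y (suc m ∸ i))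
  split {i} i<m+1 = sum-falseRows-⇀ᴸ {suc i} {suc m ∸ i} (cong suc (m+[n∸m]≡n (<⇒≤ i<m+1)))

proposition1p4 : (y 0 ≡ 0) × (y 1 ≡ 1) ×
    (∀ n → 2 ≤ n →
      y n ≡ sumFrom1 n (λ i → (2 ^ i * catalan i ∸ y i) * (2 ^ (n ∸ i) * catalan (n ∸ i) ∸ y (n ∸ i))))
proposition1p4 = refl , refl , λ where
  (suc (suc m)) (s≤s (s≤s z≤n)) → y-recurrence m
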